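{- Let $S_{FI}\subseteq S$ be the set of sorts having only finitely many infinite trees, and for each sort $s$ let $F_s^{\mathrm{infin}} := \{(g: s_1\times\cdots\times s_n\to s)\in F_s\mid \exists i\in\{1,\dots,n\}: s_i\notin S_{0I}\}$. Then $S_{FI}$ is the least fixed point of $f:\mathcal P(S)\to\mathcal P(S)$, $f(X) := X\cup S_{0I}\cup S_{1I}\cup\{ s\in S\mid |F_s^{\mathrm{infin}}|<\infty\wedge \forall (g: s_1\times\cdots\times s_n\to s)\in F_s\ \forall i\in\{1,\dots,n\}: s_i\in S_{0I}\vee (s_i\in X\wedge (\forall j\in\{1,\dots,n\}\setminus\{i\}: s_j\in S_{FF}\cap X))\}$.
   Context: Signature: a set of sorts $S$ and generators, each with an arity $g: s_1\times\cdots\times s_n\to s$ ($n\ge0$); $F_s$ is the nonempty set of generators of sort $s$; every sort is assumed to have at least two generators. A tree of sort $s$ is a (possibly infinite) rooted ordered tree whose root is labeled by some $g: s_1\times\cdots\times s_n\to s$ in $F_s$ and whose $n$ children, in order, are roots of trees of sorts $s_1,\dots,s_n$; finite if it has finitely many nodes. $S_{0I}$: sorts with no infinite trees; $S_{1I}$: sorts with exactly one infinite tree; $S_{FF}$: sorts with only finitely many finite trees. $\mathcal P(S)$ is the power set of $S$. -}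

module Defs where

open import Level using (0ℓ)
open import Data.Nat using (ℕ; _≤_)
open import Data.Maybe using (Maybe; just; nothing)
open import Data.Fin using (Fin; toℕ)
open import Data.List using (List; []; _∷_; length; lookup)
open import Data.List.Membership.Propositional using (_∈_)
open import Data.List.Relation.Unary.Any using (Any)
open import Data.Product using (Σ; ∃; _×_; _,_)
open import Data.Sum using (_⊎_)
open import Relation.Nullary using (¬_)
open import Relation.Binary.PropositionalEquality using (_≡_; _≢_)
open import Relation.Unary using (Pred; _⊆_)

record Signature : Set₁ where
  field
    Sort  : Set
    Gen   : Sort → Set
    arity : {s : Sort} → Gen s → List Sort

module _ (Σg : Signature) where
  open Signature Σg

  AtLeastTwoGens : Set
  AtLeastTwoGens = (s : Sort) → Σ (Gen s) λ g₁ → Σ (Gen s) λ g₂ → g₁ ≢ g₂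

  ar : {s : Sort} → Gen s → ℕ
  ar g = length (arity g)

  argSort : {s : Sort} (g : Gen s) → Fin (ar g) → Sort
  argSort g i = lookup (arity g) i

  Label : Set
  Label = Σ Sort Gen

  -- Node addresses.  The address of the root is [], and the k-th child
  -- (0-based) of the node at address p has address k ∷ p
  -- (addresses are read from the node up to the root).
  Address : Set
  Address = List ℕ

  -- (possibly infinite) rooted ordered labelled trees of sort s, given by
  -- their labelling of addresses (nothing = no node at this address):
  -- the root is labelled by some generator in F_s, and a node labelled by
  -- g : s₁ × ⋯ × sₙ → s' has exactly the children 0,…,n-1, the i-th one
  -- labelled by a generator of sort sᵢ.
  record Tree (s : Sort) : Set where
    field
      lab     : Address → Maybe Label
      rootOK  : Σ (Gen s) λ g → lab [] ≡ just (s , g)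
      childOK : (p : Address) (s′ : Sort) (g : Gen s′) → lab p ≡ just (s′ , g) →
                (i : Fin (ar g)) →
                Σ (Gen (argSort g i)) λ g′ → lab (toℕ i ∷ p) ≡ just (argSort g i , g′)
      noChild : (p : Address) (s′ : Sort) (g : Gen s′) → lab p ≡ just (s′ , g) →
                (k : ℕ) → ar g ≤ k → lab (k ∷ p) ≡ nothing
      noNode  : (p : Address) → lab p ≡ nothing → (k : ℕ) → lab (k ∷ p) ≡ nothing
  open Tree public

  _≈T_ : {s : Sort} → Tree s → Tree s → Set
  t ≈T u = (p : Address) → lab t p ≡ lab u p

  Finite : {s : Sort} → Tree s → Set
  Finite t = Σ (List Address) λ ps → (p : Address) → lab t p ≢ nothing → p ∈ ps

  Infinite : {s : Sort} → Tree s → Set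
  Infinite t = ¬ Finite t

  FinitelyMany : {s : Sort} → Pred (Tree s) 0ℓ → Set
  FinitelyMany {s} P = Σ (List (Tree s)) λ ts → (t : Tree s) → P t → Any (λ u → t ≈T u) ts

  S0I : Pred Sort 0ℓ
  S0I s = (t : Tree s) → ¬ Infinite t

  S1I : Pred Sort 0ℓ
  S1I s = Σ (Tree s) λ t → Infinite t × ((u : Tree s) → Infinite u → u ≈T t)

  SFF : Pred Sort 0ℓ
  SFF s = FinitelyMany {s} Finite

  SFI : Pred Sort 0ℓ
  SFI s = FinitelyMany {s} Infinite

  Finfin : (s : Sort) → Pred (Gen s) 0ℓ
  Finfin s g = Σ (Fin (ar g)) λ i → ¬ S0I (argSort g i)

  FiniteGens : (s : Sort) → Pred (Gen s) 0ℓ → Set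
  FiniteGens s P = Σ (List (Gen s)) λ gs → (g : Gen s) → P g → g ∈ gs

  f : Pred Sort 0ℓ → Pred Sort 0ℓ
  f X s = X s ⊎ S0I s ⊎ S1I s ⊎
          ( FiniteGens s (Finfin s)
          × ((g : Gen s) (i : Fin (ar g)) →
               S0I (argSort g i)
               ⊎ (X (argSort g i)
                  × ((j : Fin (ar g)) → j ≢ i →
                       SFF (argSort g j) × X (argSort g j)))))

  _≐_ : Pred Sort 0ℓ → Pred Sort 0ℓ → Set
  X ≐ Y = (X ⊆ Y) × (Y ⊆ X)

  IsLeastFixedPoint : (Pred Sort 0ℓ → Pred Sort 0ℓ) → Pred Sort 0ℓ → Set₁
  IsLeastFixedPoint F X = (F X ≐ X) × ((Y : Pred Sort 0ℓ) → F Y ≐ Y → X ⊆ Y)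

module Submission where

-- Since X ⊆ f(X), it suffices to show f(S_FI) ⊆ S_FI and S_FI ⊆ Y whenever f(Y) ⊆ Y.
--
-- An infinite tree of a sort in the fourth clause of f has an infinite child
-- at some argument i with s_i ∉ S_0I.  It is then determined by its root, one
-- of the finitely many generators of F_s^infin, and its children, which range
-- over finitely many trees: S_FI for the i-th, S_FF ∩ S_FI for the others.
--
-- Conversely, in a sort s ∈ S_FI, substituting trees into one argument of
-- g(c₁, …, cₙ) with fixed canonical trees c_j shows that F_s^infin is finite,
-- that all argument sorts lie in S_FI, and that all other arguments lie in
-- S_FF as soon as one argument sort has an infinite tree.  So a sort in
-- S_FI ∖ Y, being in neither S_0I nor S_1I, has an argument sort in S_FI ∖ Y.
-- The resulting infinite descending path carries, for every d, two distinct
-- infinite trees of s agreeing up to depth d, whereas finitely many distinct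
-- trees are separated at a bounded depth.

open import Defs
open import Level using (0ℓ)
open import Axiom.ExcludedMiddle using (ExcludedMiddle)
open import Axiom.DoubleNegationElimination using (em⇒dne)
open import Data.Nat using (ℕ; zero; suc; _+_; _∸_; _⊔_; _<_; _≤_; z≤n; s≤s; s<s⁻¹)
open import Data.Nat.Properties using (+-comm; +-suc; +-identityʳ; m+n∸n≡m; m≤m⊔n; m≤n⊔m; <-≤-trans; <⇒≱; n<1+n)
open import Data.Maybe using (Maybe; just; nothing; _>>=_)
import Data.Maybe as Maybe
open import Data.Fin using (Fin; zero; suc; toℕ) renaming (_≟_ to _≟ᶠ_)
open import Data.Fin.Properties using (toℕ<n)
open import Data.List using (List; []; _∷_; [_]; _++_; _∷ʳ_; length; reverse; map; concatMap; take; allFin; initLast; _∷ʳ′_)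
open import Data.List.Properties using (length-++; unfold-reverse; reverse-++; reverse-involutive; ++-identityʳ; ∷ʳ-++)
open import Data.List.Membership.Propositional using (_∈_; find)
open import Data.List.Membership.Propositional.Properties using (∈-map⁺; ∈-allFin)
open import Data.List.Relation.Unary.Any using (Any; here; there)
import Data.List.Relation.Unary.Any as Any
open import Data.List.Relation.Unary.Any.Properties using (concatMap⁺; map⁺; ++⁺ˡ; ++⁺ʳ)
open import Data.List.Relation.Unary.All using (All; []; _∷_; tabulate)
import Data.List.Relation.Unary.All as All
open import Data.Product using (Σ; ∃; _×_; _,_; proj₁; proj₂; map₂)
open import Data.Sum using (_⊎_; inj₁; inj₂)
open import Data.Empty using (⊥-elim)
open import Data.Unit using (⊤; tt)
open import Relation.Nullary using (¬_; yes; no)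
open import Relation.Binary.PropositionalEquality using (_≡_; _≢_; refl; sym; trans; cong; subst; subst₂; module ≡-Reasoning)
open import Relation.Unary using (Pred; _⊆_)
open import Function using (_∘_)

length-∷ʳ : ∀ {A : Set} (xs : List A) x → length (xs ∷ʳ x) ≡ suc (length xs)
length-∷ʳ xs x = trans (length-++ xs) (+-comm (length xs) 1)

take-length-++ : ∀ {A : Set} (xs ys : List A) → take (length xs) (xs ++ ys) ≡ xs
take-length-++ []       ys = refl
take-length-++ (x ∷ xs) ys = cong (x ∷_) (take-length-++ xs ys)

dropSuffix : ∀ {A : Set} → ℕ → List A → List A
dropSuffix n xs = take (length xs ∸ n) xs

dropSuffix-++ : ∀ {A : Set} (xs ys : List A) → dropSuffix (length ys) (xs ++ ys) ≡ xs
dropSuffix-++ xs ys rewrite length-++ xs {ys} | m+n∸n≡m (length xs) (length ys) = take-length-++ xs ys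

data Slot (n : ℕ) : ℕ → Set where
  inside  : (i : Fin n) → Slot n (toℕ i)
  outside : ∀ {k} → n ≤ k → Slot n k

slot : ∀ n k → Slot n k
slot zero    k       = outside z≤n
slot (suc n) zero    = inside zero
slot (suc n) (suc k) with slot n k
... | inside i    = inside (suc i)
... | outside n≤k = outside (s≤s n≤k)

slot-toℕ : ∀ {n} (i : Fin n) → slot n (toℕ i) ≡ inside i
slot-toℕ zero    = refl
slot-toℕ (suc i) rewrite slot-toℕ i = refl

module _ {n : ℕ} {B : Fin n → Set} where

  update : (i : Fin n) → B i → (∀ j → B j) → ∀ j → B j
  update i x h j with j ≟ᶠ i
  ... | yes refl = x
  ... | no  _    = h j

  update-≡ : ∀ i x h → update i x h i ≡ x
  update-≡ i x h with i ≟ᶠ i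
  ... | yes refl = refl
  ... | no  i≢i  = ⊥-elim (i≢i refl)

  update-≢ : ∀ {i j} x h → j ≢ i → update i x h j ≡ h j
  update-≢ {i} {j} x h j≢i with j ≟ᶠ i
  ... | yes j≡i = ⊥-elim (j≢i j≡i)
  ... | no  _   = refl

  update-preserves : (R : ∀ j → B j → B j → Set) → ∀ {i x y h} → (∀ j → R j (h j) (h j)) → R i x y →
                     ∀ j → R j (update i x h j) (update i y h j)
  update-preserves R {i} refl-h x~y j with j ≟ᶠ i
  ... | yes refl = x~y
  ... | no  _    = refl-h j

infixr 5 _∷ᵈ_
_∷ᵈ_ : ∀ {n} {B : Fin (suc n) → Set} → B zero → (∀ j → B (suc j)) → ∀ j → B j
(b ∷ᵈ c) zero    = b
(b ∷ᵈ c) (suc j) = c j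

choices : ∀ {n} {B : Fin n → Set} → (∀ j → List (B j)) → List (∀ j → B j)
choices {zero}  L = (λ ()) ∷ []
choices {suc n} L = concatMap (λ b → map (b ∷ᵈ_) (choices (λ j → L (suc j)))) (L zero)

choices-complete : ∀ {n} {B : Fin n → Set} (R : ∀ j → B j → B j → Set) (L : ∀ j → List (B j)) (h : ∀ j → B j) →
                   (∀ j → Any (R j (h j)) (L j)) → Any (λ c → ∀ j → R j (h j) (c j)) (choices L)
choices-complete {zero}  R L h any = here λ ()
choices-complete {suc n} R L h any =
  concatMap⁺ (λ b → map (b ∷ᵈ_) (choices (λ j → L (suc j))))
    (Any.map (λ r → map⁺ (Any.map (λ rs → λ { zero → r ; (suc j) → rs j }) rest)) (any zero))
  where
  rest : Any (λ c → ∀ j → R (suc j) (h (suc j)) (c j)) (choices (λ j → L (suc j)))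
  rest = choices-complete (λ j → R (suc j)) (λ j → L (suc j)) (λ j → h (suc j)) (λ j → any (suc j))

commonBound : ∀ {A : Set} (Q : ℕ → A → Set) → (∀ {m n x} → m ≤ n → Q m x → Q n x) →
              ∀ {xs} → All (λ x → ∃ λ n → Q n x) xs → ∃ λ n → All (Q n) xs
commonBound Q mono []             = 0 , []
commonBound Q mono ((m , q) ∷ qs) with commonBound Q mono qs
... | n , qs′ = m ⊔ n , mono (m≤m⊔n m n) q ∷ All.map (mono (m≤n⊔m m n)) qs′

module Trees (Σg : Signature) where
  open Signature Σg

  Tr : Sort → Set
  Tr = Tree Σg

  Ar : ∀ {s} → Gen s → ℕ
  Ar = ar Σg

  Arg : ∀ {s} (g : Gen s) → Fin (Ar g) → Sort
  Arg = argSort Σg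

  infix 4 _≈_
  _≈_ : ∀ {s} → Tr s → Tr s → Set
  _≈_ = _≈T_ Σg

  Agree : ∀ {s} → ℕ → Tr s → Tr s → Set
  Agree d t u = ∀ p → length p < d → lab t p ≡ lab u p

  Agree-mono : ∀ {s} {d e} {t u : Tr s} → d ≤ e → Agree e t u → Agree d t u
  Agree-mono d≤e ag p lp = ag p (<-≤-trans lp d≤e)

  OccursAt : ∀ {s s′} → Tr s → Address Σg → Tr s′ → Set
  OccursAt t a x = ∀ p → lab t (p ++ a) ≡ lab x p

  finite-occurrence : ∀ {s s′} {t : Tr s} {x : Tr s′} a → OccursAt t a x → Finite Σg t → Finite Σg x
  finite-occurrence a occ (ps , fin) = map (dropSuffix (length a)) ps , λ p x∋p →
    subst (_∈ map (dropSuffix (length a)) ps) (dropSuffix-++ p a)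
      (∈-map⁺ (dropSuffix (length a)) (fin (p ++ a) λ t∌p → x∋p (trans (sym (occ p)) t∌p)))

  infinite-occurrence : ∀ {s s′} {t : Tr s} {x : Tr s′} a → OccursAt t a x → Infinite Σg x → Infinite Σg t
  infinite-occurrence {t = t} {x} a occ inf fin = inf (finite-occurrence {t = t} {x} a occ fin)

  noNode-++ : ∀ {s} (t : Tr s) {a} → lab t a ≡ nothing → ∀ q → lab t (q ++ a) ≡ nothing
  noNode-++ t t∌a []      = t∌a
  noNode-++ t t∌a (k ∷ q) = noNode t (q ++ _) (noNode-++ t t∌a q) k

  beyondArity : ∀ {s} (t : Tr s) {g : Gen s} → lab t [] ≡ just (s , g) → ∀ q {k} → Ar g ≤ k →
                lab t (q ∷ʳ k) ≡ nothing
  beyondArity t {g} root q {k} g≤k = noNode-++ t (noChild t [] _ g root k g≤k) q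

  subtree : ∀ {s} (t : Tr s) a {s′} {g : Gen s′} → lab t a ≡ just (s′ , g) → Tr s′
  lab     (subtree t a e) p = lab t (p ++ a)
  rootOK  (subtree t a e)   = _ , e
  childOK (subtree t a e) p = childOK t (p ++ a)
  noChild (subtree t a e) p = noChild t (p ++ a)
  noNode  (subtree t a e) p = noNode t (p ++ a)

  child : ∀ {s} (t : Tr s) {g : Gen s} → lab t [] ≡ just (s , g) → (i : Fin (Ar g)) → Tr (Arg g i)
  child t {g} root i = subtree t [ toℕ i ] (proj₂ (childOK t [] _ g root i))

  agree-byChildren : ∀ {s} {t u : Tr s} {g : Gen s} {d} → lab t [] ≡ just (s , g) → lab u [] ≡ just (s , g) →
                     (∀ i q → length q < d → lab t (q ∷ʳ toℕ i) ≡ lab u (q ∷ʳ toℕ i)) → Agree (suc d) t u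
  agree-byChildren {t = t} {u} {g} roott rootu ag p lp with initLast p
  ... | []      = trans roott (sym rootu)
  ... | q ∷ʳ′ k with slot (Ar g) k
  ...   | inside i    = ag i q (s<s⁻¹ (subst (_< suc _) (length-∷ʳ q k) lp))
  ...   | outside g≤k = trans (beyondArity t roott q g≤k) (sym (beyondArity u rootu q g≤k))

  ≈-byChildren : ∀ {s} {t u : Tr s} {g : Gen s} (roott : lab t [] ≡ just (s , g)) (rootu : lab u [] ≡ just (s , g)) →
                 (∀ i → child t roott i ≈ child u rootu i) → t ≈ u
  ≈-byChildren {t = t} {u} roott rootu eq p =
    agree-byChildren {t = t} {u} {d = length p} roott rootu (λ i q _ → eq i q) p (n<1+n _)

  finite-byChildren : ∀ {s} (t : Tr s) {g : Gen s} (root : lab t [] ≡ just (s , g)) →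
                      (∀ i → Finite Σg (child t root i)) → Finite Σg t
  finite-byChildren t {g} root fin = [] ∷ concatMap childNodes (allFin (Ar g)) , covers
    where
    childNodes : Fin (Ar g) → List (Address Σg)
    childNodes i = map (_∷ʳ toℕ i) (proj₁ (fin i))

    covers : ∀ p → lab t p ≢ nothing → p ∈ [] ∷ concatMap childNodes (allFin (Ar g))
    covers p t∋p with initLast p
    ... | []      = here refl
    ... | q ∷ʳ′ k with slot (Ar g) k
    ...   | inside i    = there (concatMap⁺ childNodes
                              (Any.map (λ { refl → ∈-map⁺ (_∷ʳ toℕ i) (proj₂ (fin i) q t∋p) }) (∈-allFin i)))
    ...   | outside g≤k = ⊥-elim (t∋p (beyondArity t root q g≤k))

  -- Addresses are read from the node upwards, so a node is reached by
  -- walking its reversed address from the root.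
  module Unfold {Q : Sort → Set} (label : ∀ {s} → Q s → Gen s)
                (next : ∀ {s} (q : Q s) (i : Fin (Ar (label q))) → Q (Arg (label q) i)) where

    walk : ∀ {s} → Q s → List ℕ → Maybe (Σ Sort Q)
    walk {s} q []       = just (s , q)
    walk     q (k ∷ ks) with slot (Ar (label q)) k
    ... | inside i  = walk (next q i) ks
    ... | outside _ = nothing

    walk-inside : ∀ {s} (q : Q s) i ks → walk q (toℕ i ∷ ks) ≡ walk (next q i) ks
    walk-inside q i ks rewrite slot-toℕ i = refl

    walk-∷ʳ : ∀ {s} (q : Q s) ks k → walk q (ks ∷ʳ k) ≡ (walk q ks >>= λ (_ , q′) → walk q′ [ k ])
    walk-∷ʳ q []       k = refl
    walk-∷ʳ q (k′ ∷ ks) k with slot (Ar (label q)) k′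
    ... | inside i  = walk-∷ʳ (next q i) ks k
    ... | outside _ = refl

    labelOf : Maybe (Σ Sort Q) → Maybe (Label Σg)
    labelOf = Maybe.map (map₂ label)

    unfold : ∀ {s} → Q s → Tr s
    lab     (unfold q) p = labelOf (walk q (reverse p))
    rootOK  (unfold q)   = label q , refl
    childOK (unfold q) p s′ g at i rewrite unfold-reverse (toℕ i) p | walk-∷ʳ q (reverse p) (toℕ i)
      with walk q (reverse p) | at
    ... | just (_ , q′) | refl rewrite walk-inside q′ i [] = label (next q′ i) , refl
    noChild (unfold q) p s′ g at k g≤k rewrite unfold-reverse k p | walk-∷ʳ q (reverse p) k
      with walk q (reverse p) | at
    ... | just (_ , q′) | refl with slot (Ar (label q′)) k
    ...   | inside i  = ⊥-elim (<⇒≱ (toℕ<n i) g≤k)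
    ...   | outside _ = refl
    noNode  (unfold q) p t∌p k rewrite unfold-reverse k p | walk-∷ʳ q (reverse p) k
      with walk q (reverse p) | t∌p
    ... | nothing | _ = refl

  canonical : (∀ s → Gen s) → ∀ s → Tr s
  canonical pick s = Unfold.unfold {Q = λ _ → ⊤} (λ {s} _ → pick s) (λ _ _ → tt) tt

  record Node (s : Sort) : Set where
    constructor node
    field
      {host} : Sort
      tree   : Tr host
      addr   : Address Σg
      gen    : Gen s
      at     : lab tree addr ≡ just (s , gen)
  open Node

  rootNode : ∀ {s} → Tr s → Node s
  rootNode t = node t [] (proj₁ (rootOK t)) (proj₂ (rootOK t))

  subnode : ∀ {s} (n : Node s) (i : Fin (Ar (gen n))) → Node (Arg (gen n) i)
  subnode (node t a g at) i = node t (toℕ i ∷ a) (proj₁ (childOK t a _ g at i)) (proj₂ (childOK t a _ g at i))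

  -- States of the tree g₀(fam₀, …, famₙ₋₁): its root, or a node of some famᵢ.
  data GraftState {s₀} (g₀ : Gen s₀) : Sort → Set where
    top   : GraftState g₀ s₀
    below : ∀ {s} → Node s → GraftState g₀ s

  module Graft {s₀} (g₀ : Gen s₀) (fam : ∀ j → Tr (Arg g₀ j)) where

    label : ∀ {s} → GraftState g₀ s → Gen s
    label top       = g₀
    label (below n) = gen n

    next : ∀ {s} (q : GraftState g₀ s) (i : Fin (Ar (label q))) → GraftState g₀ (Arg (label q) i)
    next top       i = below (rootNode (fam i))
    next (below n) i = below (subnode n i)

    open Unfold label next public

    walk-below : ∀ {s} (n : Node s) ks → labelOf (walk (below n) ks) ≡ lab (tree n) (reverse ks ++ addr n)
    walk-below n [] = sym (at n)
    walk-below n (k ∷ ks) with slot (Ar (gen n)) k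
    ... | inside i rewrite unfold-reverse (toℕ i) ks | ∷ʳ-++ (reverse ks) (toℕ i) (addr n) = walk-below (subnode n i) ks
    ... | outside g≤k rewrite unfold-reverse k ks | ∷ʳ-++ (reverse ks) k (addr n) =
      sym (noNode-++ (tree n) (noChild (tree n) (addr n) _ (gen n) (at n) k g≤k) (reverse ks))

  graft : ∀ {s} (g : Gen s) → (∀ j → Tr (Arg g j)) → Tr s
  graft g fam = Graft.unfold g fam top

  graft-occurs : ∀ {s} (g : Gen s) (fam : ∀ j → Tr (Arg g j)) j → OccursAt (graft g fam) [ toℕ j ] (fam j)
  graft-occurs g fam j p = begin
    labelOf (walk top (reverse (p ∷ʳ toℕ j)))              ≡⟨ cong (labelOf ∘ walk top) (reverse-++ p [ toℕ j ]) ⟩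
    labelOf (walk top (toℕ j ∷ reverse p))                 ≡⟨ cong labelOf (walk-inside top j (reverse p)) ⟩
    labelOf (walk (below (rootNode (fam j))) (reverse p))  ≡⟨ walk-below (rootNode (fam j)) (reverse p) ⟩
    lab (fam j) (reverse (reverse p) ++ [])                 ≡⟨ cong (lab (fam j)) (trans (++-identityʳ _) (reverse-involutive p)) ⟩
    lab (fam j) p                                           ∎
    where
    open Graft g fam
    open ≡-Reasoning

  graft-agree : ∀ {s} (g : Gen s) (fam fam′ : ∀ j → Tr (Arg g j)) {d} →
                (∀ j → Agree d (fam j) (fam′ j)) → Agree (suc d) (graft g fam) (graft g fam′)
  graft-agree g fam fam′ ag = agree-byChildren {t = graft g fam} {graft g fam′} refl refl λ i q lq →
    trans (graft-occurs g fam i q) (trans (ag i q lq) (sym (graft-occurs g fam′ i q)))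

  graft-cancel : ∀ {s} (g : Gen s) (fam fam′ : ∀ j → Tr (Arg g j)) j → graft g fam ≈ graft g fam′ → fam j ≈ fam′ j
  graft-cancel g fam fam′ j eq p =
    trans (sym (graft-occurs g fam j p)) (trans (eq (p ∷ʳ toℕ j)) (graft-occurs g fam′ j p))

  graft-infinite : ∀ {s} (g : Gen s) (fam : ∀ j → Tr (Arg g j)) j → Infinite Σg (fam j) → Infinite Σg (graft g fam)
  graft-infinite g fam j = infinite-occurrence {t = graft g fam} {fam j} [ toℕ j ] (graft-occurs g fam j)

  plug-infinite : ∀ {s} (g : Gen s) (h : ∀ j → Tr (Arg g j)) i x → Infinite Σg x → Infinite Σg (graft g (update i x h))
  plug-infinite g h i x inf = graft-infinite g (update i x h) i (subst (Infinite Σg) (sym (update-≡ i x h)) inf)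

module Classical (em : ExcludedMiddle 0ℓ) (Σg : Signature) where
  open Signature Σg
  open Trees Σg

  dne : ∀ {P : Set} → ¬ ¬ P → P
  dne = em⇒dne em

  someInfinite : ∀ {s} → ¬ S0I Σg s → Σ (Tr s) (Infinite Σg)
  someInfinite ¬s0I = dne λ none → ¬s0I λ t inf → none (t , inf)

  anotherInfinite : ∀ {s} → ¬ S1I Σg s → (t : Tr s) → Infinite Σg t → Σ (Tr s) λ u → Infinite Σg u × ¬ u ≈ t
  anotherInfinite ¬s1I t inf = dne λ none → ¬s1I (t , inf , λ u infu → dne λ u≉t → none (u , infu , u≉t))

  infinite-child : ∀ {s} (t : Tr s) {g : Gen s} (root : lab t [] ≡ just (s , g)) → Infinite Σg t →
                   ∃ λ i → Infinite Σg (child t root i)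
  infinite-child t root inf = dne λ none → inf (finite-byChildren t root λ i → dne λ infᵢ → none (i , infᵢ))

  finitelyMany-byCodes : ∀ {s} {K : Set} {P : Tr s → Set} (codes : List K) (Encodes : Tr s → K → Set) →
                         (∀ t → P t → Any (Encodes t) codes) → (∀ {t u c} → Encodes t c → Encodes u c → t ≈ u) →
                         FinitelyMany Σg P
  finitelyMany-byCodes {s} {K} {P} codes Encodes complete unique =
    concatMap representative codes , λ t pt → concatMap⁺ representative (Any.map (represented pt) (complete t pt))
    where
    representative : K → List (Tr s)
    representative c with em {∃ λ t → P t × Encodes t c}
    ... | yes (t , _) = [ t ]
    ... | no  _       = []

    represented : ∀ {t c} → P t → Encodes t c → Any (t ≈_) (representative c)
    represented {t} {c} pt enc with em {∃ λ t → P t × Encodes t c}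
    ... | yes (u , _ , enc′) = here (unique enc enc′)
    ... | no  none           = ⊥-elim (none (t , pt , enc))

  finitelyMany-all : ∀ {s} → SFF Σg s → SFI Σg s → FinitelyMany Σg {s} (λ _ → ⊤)
  finitelyMany-all (fin , fin-complete) (inf , inf-complete) = fin ++ inf , covers
    where
    covers : ∀ t → ⊤ → Any (t ≈_) (fin ++ inf)
    covers t _ with em {Finite Σg t}
    ... | yes finite    = ++⁺ˡ (fin-complete t finite)
    ... | no  ¬finite   = ++⁺ʳ fin (inf-complete t ¬finite)

  ArgCondition : Pred Sort 0ℓ → ∀ {s} (g : Gen s) → Fin (Ar g) → Set
  ArgCondition X g i = S0I Σg (Arg g i) ⊎ (X (Arg g i) × (∀ j → j ≢ i → SFF Σg (Arg g j) × X (Arg g j)))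

  SFI-byArgConditions : ∀ {s} → FiniteGens Σg s (Finfin Σg s) → (∀ g i → ArgCondition (SFI Σg) g i) → SFI Σg s
  SFI-byArgConditions {s} (gens , gens-complete) cond = finitelyMany-byCodes codes Encodes complete unique
    where
    Code : Set
    Code = Σ (Gen s) λ g → ∀ j → Tr (Arg g j)

    record Encodes (t : Tr s) (code : Code) : Set where
      constructor encodes
      field
        root     : lab t [] ≡ just (s , proj₁ code)
        children : ∀ j → child t root j ≈ proj₂ code j

    module _ {g : Gen s} {i : Fin (Ar g)} (sfi : SFI Σg (Arg g i))
             (others : ∀ j → j ≢ i → SFF Σg (Arg g j) × SFI Σg (Arg g j)) where

      candidates : ∀ j → List (Tr (Arg g j))
      candidates j with j ≟ᶠ i
      ... | yes refl = proj₁ sfi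
      ... | no  j≢i  = proj₁ (finitelyMany-all (proj₁ (others j j≢i)) (proj₂ (others j j≢i)))

      candidates-complete : (x : ∀ j → Tr (Arg g j)) → Infinite Σg (x i) → ∀ j → Any (x j ≈_) (candidates j)
      candidates-complete x inf j with j ≟ᶠ i
      ... | yes refl = proj₂ sfi (x i) inf
      ... | no  j≢i  = proj₂ (finitelyMany-all (proj₁ (others j j≢i)) (proj₂ (others j j≢i))) (x j) tt

    codesFor : (g : Gen s) (i : Fin (Ar g)) → ArgCondition (SFI Σg) g i → List Code
    codesFor g i (inj₁ _)              = []
    codesFor g i (inj₂ (sfi , others)) = map (g ,_) (choices (candidates sfi others))

    codesAt : Gen s → List Code
    codesAt g = concatMap (λ i → codesFor g i (cond g i)) (allFin (Ar g))

    codes : List Code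
    codes = concatMap codesAt gens

    complete : ∀ t → Infinite Σg t → Any (Encodes t) codes
    complete t inf = concatMap⁺ codesAt (Any.map (λ { refl → inCodesAt }) (gens-complete g (i , infinite-arg)))
      where
      g : Gen s
      g = proj₁ (rootOK t)
      root : lab t [] ≡ just (s , g)
      root = proj₂ (rootOK t)
      i : Fin (Ar g)
      i = proj₁ (infinite-child t root inf)
      infinite-arg : ¬ S0I Σg (Arg g i)
      infinite-arg s0I = s0I (child t root i) (proj₂ (infinite-child t root inf))

      inCodesFor : (c : ArgCondition (SFI Σg) g i) → Any (Encodes t) (codesFor g i c)
      inCodesFor (inj₁ s0I)            = ⊥-elim (infinite-arg s0I)
      inCodesFor (inj₂ (sfi , others)) = map⁺ (Any.map (encodes root)
        (choices-complete (λ _ → _≈_) (candidates sfi others) (child t root)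
          (candidates-complete sfi others (child t root) (proj₂ (infinite-child t root inf)))))

      inCodesAt : Any (Encodes t) (codesAt g)
      inCodesAt = concatMap⁺ (λ i → codesFor g i (cond g i)) (Any.map (λ { refl → inCodesFor (cond g i) }) (∈-allFin i))

    unique : ∀ {t u c} → Encodes t c → Encodes u c → t ≈ u
    unique {t} {u} enct encu = ≈-byChildren {t = t} {u} (Encodes.root enct) (Encodes.root encu) λ j p →
      trans (Encodes.children enct j p) (sym (Encodes.children encu j p))

  f-SFI⊆SFI : f Σg (SFI Σg) ⊆ SFI Σg
  f-SFI⊆SFI (inj₁ sfi)                                  = sfi
  f-SFI⊆SFI (inj₂ (inj₁ s0I))                           = [] , λ t inf → ⊥-elim (s0I t inf)
  f-SFI⊆SFI (inj₂ (inj₂ (inj₁ (t , inf , unique))))     = [ t ] , λ u infu → here (unique u infu)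
  f-SFI⊆SFI (inj₂ (inj₂ (inj₂ (gens , cond))))          = SFI-byArgConditions gens cond

  pairDepth : ∀ {s} (u v : Tr s) → ∃ λ d → Agree d u v → u ≈ v
  pairDepth u v with em {u ≈ v}
  ... | yes u≈v = 0 , λ _ → u≈v
  ... | no  u≉v = suc (length p) , λ ag → ⊥-elim (differ (ag p (n<1+n _)))
    where
    witness : ∃ λ p → lab u p ≢ lab v p
    witness = dne λ none → u≉v λ p → dne λ differ → none (p , differ)
    p : Address Σg
    p = proj₁ witness
    differ : lab u p ≢ lab v p
    differ = proj₂ witness

  separationDepth : ∀ {s} (L : List (Tr s)) → ∃ λ d → ∀ {u v} → u ∈ L → v ∈ L → Agree d u v → u ≈ v
  separationDepth {s} L = proj₁ bound , λ u∈L v∈L → All.lookup (All.lookup (proj₂ bound) u∈L) v∈L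
    where
    Separates : ℕ → Tr s → Tr s → Set
    Separates d u v = Agree d u v → u ≈ v

    separates-mono : ∀ {m n} u v → m ≤ n → Separates m u v → Separates n u v
    separates-mono u v m≤n sep ag = sep (Agree-mono {t = u} {v} m≤n ag)

    bound : ∃ λ d → All (λ u → All (Separates d u) L) L
    bound = commonBound (λ d u → All (Separates d u) L) (λ {_} {_} {u} m≤n → All.map (λ {v} → separates-mono u v m≤n))
      (tabulate λ {u} _ → commonBound (λ d v → Separates d u v) (λ {_} {_} {v} → separates-mono u v)
                             (tabulate λ {v} _ → pairDepth u v))

  module _ (pick : ∀ s → Gen s) where

    canonicalArgs : ∀ {s} (g : Gen s) j → Tr (Arg g j)
    canonicalArgs g j = canonical pick (Arg g j)

    -- y ↦ g(h[j ≔ y]) is injective up to ≈, so finiteness passes from s to the j-th argument sort.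
    finitelyMany-viaGraft : ∀ {s} → SFI Σg s → ∀ (g : Gen s) (h : ∀ j → Tr (Arg g j)) j {P : Tr (Arg g j) → Set} →
                            (∀ y → P y → Infinite Σg (graft g (update j y h))) → FinitelyMany Σg P
    finitelyMany-viaGraft (L , complete) g h j infinite =
      finitelyMany-byCodes L (λ y u → graft g (update j y h) ≈ u) (λ y py → complete (graft g (update j y h)) (infinite y py))
        λ {y} {z} {u} y↦u z↦u → subst₂ _≈_ (update-≡ j y h) (update-≡ j z h)
          (graft-cancel g (update j y h) (update j z h) j λ p → trans (y↦u p) (sym (z↦u p)))

    SFI⇒argSFI : ∀ {s} → SFI Σg s → ∀ (g : Gen s) j → SFI Σg (Arg g j)
    SFI⇒argSFI sfi g j = finitelyMany-viaGraft sfi g (canonicalArgs g) j (plug-infinite g (canonicalArgs g) j)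

    SFI⇒othersSFF : ∀ {s} → SFI Σg s → ∀ (g : Gen s) i → Σ (Tr (Arg g i)) (Infinite Σg) →
                    ∀ j → j ≢ i → SFF Σg (Arg g j)
    SFI⇒othersSFF sfi g i (x , inf) j j≢i = finitelyMany-viaGraft sfi g (update i x (canonicalArgs g)) j λ y _ →
      graft-infinite g _ i (subst (Infinite Σg) (sym (trans (update-≢ y _ (j≢i ∘ sym)) (update-≡ i x _))) inf)

    SFI⇒finiteFinfin : ∀ {s} → SFI Σg s → FiniteGens Σg s (Finfin Σg s)
    SFI⇒finiteFinfin {s} (L , complete) = map rootGen L , λ g (i , ¬s0I) → inRoots g i (someInfinite ¬s0I)
      where
      rootGen : Tr s → Gen s
      rootGen t = proj₁ (rootOK t)

      just-injective : ∀ {g g′ : Gen s} → _≡_ {A = Maybe (Label Σg)} (just (s , g)) (just (s , g′)) → g ≡ g′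
      just-injective refl = refl

      inRoots : ∀ (g : Gen s) i → Σ (Tr (Arg g i)) (Infinite Σg) → g ∈ map rootGen L
      inRoots g i (x , inf)
        with find (complete (graft g (update i x (canonicalArgs g))) (plug-infinite g (canonicalArgs g) i x inf))
      ... | u , u∈L , graft≈u =
        subst (_∈ map rootGen L) (sym (just-injective (trans (graft≈u []) (proj₂ (rootOK u))))) (∈-map⁺ rootGen u∈L)

    -- lift n plugs a tree of the n-th sort of the path into the canonical
    -- contexts above it, so distinct trees stay distinct and gain n levels of agreement.
    ¬SFI-ifDescending : (P : Sort → Set) → (∀ {s} → P s → Σ (Gen s) λ g → Σ (Fin (Ar g)) λ i → P (Arg g i)) →
                        (∀ {s} → P s → ¬ S0I Σg s) → (∀ {s} → P s → ¬ S1I Σg s) → ∀ {s} → P s → ¬ SFI Σg s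
    ¬SFI-ifDescending P descend ¬s0I ¬s1I {s₀} p₀ (L , complete) = b≉a (λ q → sym (lift-cancel d a b a≈b q))
      where
      path : ℕ → Σ Sort P
      path zero    = s₀ , p₀
      path (suc n) = Arg (proj₁ (descend (proj₂ (path n)))) (proj₁ (proj₂ (descend (proj₂ (path n))))) ,
                     proj₂ (proj₂ (descend (proj₂ (path n))))

      sort : ℕ → Sort
      sort n = proj₁ (path n)

      gen : ∀ n → Gen (sort n)
      gen n = proj₁ (descend (proj₂ (path n)))

      idx : ∀ n → Fin (Ar (gen n))
      idx n = proj₁ (proj₂ (descend (proj₂ (path n))))

      raise : ∀ n → Tr (sort (suc n)) → Tr (sort n)
      raise n x = graft (gen n) (update (idx n) x (canonicalArgs (gen n)))

      lift : ∀ n → Tr (sort n) → Tr s₀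
      lift zero    x = x
      lift (suc n) x = lift n (raise n x)

      lift-infinite : ∀ n x → Infinite Σg x → Infinite Σg (lift n x)
      lift-infinite zero    x inf = inf
      lift-infinite (suc n) x inf = lift-infinite n (raise n x) (plug-infinite (gen n) _ (idx n) x inf)

      lift-cancel : ∀ n x y → lift n x ≈ lift n y → x ≈ y
      lift-cancel zero    x y eq = eq
      lift-cancel (suc n) x y eq = subst₂ _≈_ (update-≡ (idx n) x _) (update-≡ (idx n) y _)
        (graft-cancel (gen n) _ _ (idx n) (lift-cancel n (raise n x) (raise n y) eq))

      lift-agree : ∀ n {e} x y → Agree e x y → Agree (n + e) (lift n x) (lift n y)
      lift-agree zero    x y ag = ag
      lift-agree (suc n) {e} x y ag = subst (λ e′ → Agree e′ (lift (suc n) x) (lift (suc n) y)) (+-suc n e)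
        (lift-agree n (raise n x) (raise n y)
          (graft-agree (gen n) _ _ (update-preserves (λ j → Agree e) (λ j _ _ → refl) ag)))

      d : ℕ
      d = proj₁ (separationDepth L)

      a : Tr (sort d)
      a = proj₁ (someInfinite (¬s0I (proj₂ (path d))))

      a-infinite : Infinite Σg a
      a-infinite = proj₂ (someInfinite (¬s0I (proj₂ (path d))))

      b : Tr (sort d)
      b = proj₁ (anotherInfinite (¬s1I (proj₂ (path d))) a a-infinite)

      b-infinite : Infinite Σg b
      b-infinite = proj₁ (proj₂ (anotherInfinite (¬s1I (proj₂ (path d))) a a-infinite))

      b≉a : ¬ b ≈ a
      b≉a = proj₂ (proj₂ (anotherInfinite (¬s1I (proj₂ (path d))) a a-infinite))

      a≈b : lift d a ≈ lift d b
      a≈b with find (complete (lift d a) (lift-infinite d a a-infinite))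
               | find (complete (lift d b) (lift-infinite d b b-infinite))
      ... | u , u∈L , a≈u | v , v∈L , b≈v = λ q → trans (a≈u q) (trans (u≈v q) (sym (b≈v q)))
        where
        agree : Agree (d + 0) (lift d a) (lift d b)
        agree = lift-agree d a b λ _ ()
        u≈v : u ≈ v
        u≈v = proj₂ (separationDepth L) u∈L v∈L λ q lq →
          trans (sym (a≈u q)) (trans (agree q (subst (length q <_) (sym (+-identityʳ d)) lq)) (b≈v q))

    SFI⊆prefixedPoint : (Y : Pred Sort 0ℓ) → f Σg Y ⊆ Y → SFI Σg ⊆ Y
    SFI⊆prefixedPoint Y fY⊆Y {s} sfi = dne λ ¬Ys → ¬SFI-ifDescending Outside descend ¬s0I ¬s1I (sfi , ¬Ys) sfi
      where
      Outside : Sort → Set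
      Outside s = SFI Σg s × ¬ Y s

      ¬s0I : ∀ {s} → Outside s → ¬ S0I Σg s
      ¬s0I (_ , ¬Ys) s0I = ¬Ys (fY⊆Y (inj₂ (inj₁ s0I)))

      ¬s1I : ∀ {s} → Outside s → ¬ S1I Σg s
      ¬s1I (_ , ¬Ys) s1I = ¬Ys (fY⊆Y (inj₂ (inj₂ (inj₁ s1I))))

      descend : ∀ {s} → Outside s → Σ (Gen s) λ g → Σ (Fin (Ar g)) λ i → Outside (Arg g i)
      descend {s} (sfi , ¬Ys) = dne λ none → ¬Ys (fY⊆Y (inj₂ (inj₂ (inj₂ (SFI⇒finiteFinfin sfi , condition none)))))
        where
        condition : ¬ (Σ (Gen s) λ g → Σ (Fin (Ar g)) λ i → Outside (Arg g i)) → ∀ g i → ArgCondition Y g i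
        condition none g i with em {S0I Σg (Arg g i)}
        ... | yes s0I = inj₁ s0I
        ... | no ¬s0I = inj₂ (inY i , λ j j≢i → SFI⇒othersSFF sfi g i (someInfinite ¬s0I) j j≢i , inY j)
          where
          inY : ∀ j → Y (Arg g j)
          inY j = dne λ ¬Y → none (g , j , SFI⇒argSFI sfi g j , ¬Y)

lemma6 : ExcludedMiddle 0ℓ → (Σg : Signature) → AtLeastTwoGens Σg →
         IsLeastFixedPoint Σg (f Σg) (SFI Σg)
lemma6 em Σg two = (f-SFI⊆SFI , inj₁) , λ Y fY≐Y → SFI⊆prefixedPoint (λ s → proj₁ (two s)) Y (proj₁ fY≐Y)
  where open Classical em Σg
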